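{- Let $P$ be an $m \times n$ $0,1$-matrix and suppose there are $p$ distinct integers $1 \le i_1, \ldots, i_p < m$ such that every corner in $P$ is of the form $P[i_j:(i_j+1)][k:(k+1)]$ for some $1 \le j \le p$ and $1 \le k < n$. Then $P$ has at most $2^{p+1}$ distinct columns.
   Context: $P[i:i'][k:k']$ denotes the submatrix formed by rows $i$ through $i'$ and columns $k$ through $k'$. A matrix is vertical if all its rows are equal, horizontal if all its columns are equal, and mixed if it is neither; a corner is a $2\times 2$ mixed submatrix (formed by two consecutive rows and two consecutive columns). -}

module Defs where

open import Data.Bool using (Bool)
open import Data.Nat using (ℕ; suc; _<_)
open import Data.Fin using (Fin; toℕ)
open import Data.Product using (_×_; Σ)
open import Relation.Nullary using (¬_)
open import Relation.Binary.PropositionalEquality using (_≡_)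

-- An m × n 0,1-matrix: entry P i k (row i, column k), 0-based indices.
Matrix : ℕ → ℕ → Set
Matrix m n = Fin m → Fin n → Bool

Vertical₂ : ∀ {m n} → Matrix m n → Fin m → Fin m → Fin n → Fin n → Set
Vertical₂ P i i' k k' = (P i k ≡ P i' k) × (P i k' ≡ P i' k')

Horizontal₂ : ∀ {m n} → Matrix m n → Fin m → Fin m → Fin n → Fin n → Set
Horizontal₂ P i i' k k' = (P i k ≡ P i k') × (P i' k ≡ P i' k')

Mixed₂ : ∀ {m n} → Matrix m n → Fin m → Fin m → Fin n → Fin n → Set
Mixed₂ P i i' k k' = ¬ Vertical₂ P i i' k k' × ¬ Horizontal₂ P i i' k k'

Corner : ∀ {m n} → Matrix m n → Fin m → Fin m → Fin n → Fin n → Set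
Corner P i i' k k' =
  (toℕ i' ≡ suc (toℕ i)) × (toℕ k' ≡ suc (toℕ k)) × Mixed₂ P i i' k k'

{-# OPTIONS --safe #-}
-- Between two consecutive rows without a corner, the xor of the two rows is
-- the same in every column, so one row determines the other: columns that
-- agree on row i also agree on row i + 1. Hence a column is determined by its
-- entries on the first row and on the p rows i_j + 1, and there are at most
-- 2^(p+1) such patterns.
module Submission where

open import Defs
open import Data.Bool using (Bool; true; false; _xor_; _≟_)
open import Data.Bool.Properties using (not-involutive; xor-same)
open import Data.Nat using (ℕ; zero; suc; _<_; _≤_; _^_)
import Data.Nat as ℕ
open import Data.Fin using (Fin; toℕ; fromℕ<; inject₁; funToFin; finToFun)
import Data.Fin as Fin
open import Data.Fin.Properties
  using (toℕ-inject₁; toℕ-injective; toℕ-fromℕ<; finToFun-funToFin; injective⇒≤; any?; 2↔Bool)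
open import Data.Fin.Induction using (<-weakInduction)
open import Data.Product using (Σ; _,_)
open import Data.Empty using (⊥-elim)
open import Function using (_∘_)
open import Function.Bundles using (Inverse)
open import Function.Definitions using (Injective)
open import Relation.Nullary using (¬_; yes; no)
open import Relation.Binary.PropositionalEquality
  using (_≡_; _≗_; refl; sym; trans; cong; cong₂; subst; module ≡-Reasoning)

private
  variable
    A : Set
    m n p k : ℕ

Consecutive : Fin n → Fin n → Set
Consecutive k k' = toℕ k' ≡ suc (toℕ k)

consecutive-inject₁ : (i : Fin n) → Consecutive (inject₁ i) (Fin.suc i)
consecutive-inject₁ i = cong suc (sym (toℕ-inject₁ i))

consecutive⇒constant : (h : Fin n → A) → (∀ k k' → Consecutive k k' → h k ≡ h k')
  → ∀ x y → h x ≡ h y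
consecutive⇒constant {n = suc n} h step x y = trans (≡h₀ x) (sym (≡h₀ y))
  where
  ≡h₀ : ∀ x → h x ≡ h Fin.zero
  ≡h₀ = <-weakInduction (λ x → h x ≡ h Fin.zero) refl
          (λ i hi≡h₀ → trans (sym (step _ _ (consecutive-inject₁ i))) hi≡h₀)

xor-cancelˡ : ∀ a b → a xor (a xor b) ≡ b
xor-cancelˡ false b = refl
xor-cancelˡ true  b = not-involutive b

rowXor : Matrix m n → Fin m → Fin m → Fin n → Bool
rowXor P i i' k = P i k xor P i' k

module _ (P : Matrix m n) (i i' : Fin m) where

  vertical₂⇒rowXor≡ : ∀ {k k'} → Vertical₂ P i i' k k' → rowXor P i i' k ≡ rowXor P i i' k'
  vertical₂⇒rowXor≡ {k} {k'} (e , e') = begin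
    P i k xor P i' k    ≡⟨ cong (_xor P i' k) e ⟩
    P i' k xor P i' k   ≡⟨ xor-same (P i' k) ⟩
    false               ≡⟨ sym (xor-same (P i' k')) ⟩
    P i' k' xor P i' k' ≡⟨ cong (_xor P i' k') (sym e') ⟩
    P i k' xor P i' k'  ∎
    where open ≡-Reasoning

  horizontal₂⇒rowXor≡ : ∀ {k k'} → Horizontal₂ P i i' k k' → rowXor P i i' k ≡ rowXor P i i' k'
  horizontal₂⇒rowXor≡ (e , e') = cong₂ _xor_ e e'

  ¬mixed₂⇒rowXor≡ : ∀ {k k'} → ¬ Mixed₂ P i i' k k' → rowXor P i i' k ≡ rowXor P i i' k'
  ¬mixed₂⇒rowXor≡ {k} {k'} ¬mixed with rowXor P i i' k ≟ rowXor P i i' k'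
  ... | yes eq = eq
  ... | no neq = ⊥-elim (¬mixed (neq ∘ vertical₂⇒rowXor≡ , neq ∘ horizontal₂⇒rowXor≡))

  unmixed-rows-preserve-agreement : (∀ k k' → Consecutive k k' → ¬ Mixed₂ P i i' k k')
    → ∀ x y → P i x ≡ P i y → P i' x ≡ P i' y
  unmixed-rows-preserve-agreement unmixed x y agree = begin
    P i' x                        ≡⟨ sym (xor-cancelˡ (P i x) (P i' x)) ⟩
    P i x xor rowXor P i i' x     ≡⟨ cong₂ _xor_ agree rowXor-constant ⟩
    P i y xor rowXor P i i' y     ≡⟨ xor-cancelˡ (P i y) (P i' y) ⟩
    P i' y                        ∎
    where
    open ≡-Reasoning
    rowXor-constant : rowXor P i i' x ≡ rowXor P i i' y
    rowXor-constant = consecutive⇒constant (rowXor P i i')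
      (λ k k' c → ¬mixed₂⇒rowXor≡ (unmixed k k' c)) x y

CornerRows : Matrix m n → (Fin p → ℕ) → Set
CornerRows {p = p} P f =
  ∀ i i' k k' → Corner P i i' k k' → Σ (Fin p) (λ j → f j ≡ toℕ i)

agreement-from-anchor-rows : (P : Matrix (suc m) n) (f : Fin p → ℕ) → CornerRows P f
  → ∀ x y → P Fin.zero x ≡ P Fin.zero y
  → (∀ j r → toℕ r ≡ suc (f j) → P r x ≡ P r y)
  → ∀ r → P r x ≡ P r y
agreement-from-anchor-rows P f corners x y agree₀ anchored =
  <-weakInduction (λ r → P r x ≡ P r y) agree₀ step
  where
  step : ∀ i → P (inject₁ i) x ≡ P (inject₁ i) y → P (Fin.suc i) x ≡ P (Fin.suc i) y
  step i agree with any? (λ j → f j ℕ.≟ toℕ i)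
  ... | yes (j , fj≡i) = anchored j (Fin.suc i) (cong suc (sym fj≡i))
  ... | no notCornerRow =
    unmixed-rows-preserve-agreement P (inject₁ i) (Fin.suc i) unmixed x y agree
    where
    unmixed : ∀ k k' → Consecutive k k' → ¬ Mixed₂ P (inject₁ i) (Fin.suc i) k k'
    unmixed k k' consecutive mixed
      with corners _ _ k k' (consecutive-inject₁ i , consecutive , mixed)
    ... | j , fj≡i = notCornerRow (j , trans fj≡i (toℕ-inject₁ i))

anchorSignature : (P : Matrix (suc m) n) (f : Fin p → ℕ) → (∀ j → suc (f j) < suc m)
  → Fin n → Fin (suc p) → Bool
anchorSignature P f bound x Fin.zero    = P Fin.zero x
anchorSignature P f bound x (Fin.suc j) = P (fromℕ< (bound j)) x

anchorSignature-determines-column : (P : Matrix (suc m) n) (f : Fin p → ℕ)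
  (bound : ∀ j → suc (f j) < suc m) → CornerRows P f
  → ∀ x y → anchorSignature P f bound x ≗ anchorSignature P f bound y
  → ∀ r → P r x ≡ P r y
anchorSignature-determines-column P f bound corners x y same =
  agreement-from-anchor-rows P f corners x y (same Fin.zero) anchored
  where
  anchored : ∀ j r → toℕ r ≡ suc (f j) → P r x ≡ P r y
  anchored j r r≡fj+1 = subst (λ r → P r x ≡ P r y) (sym r≡anchor) (same (Fin.suc j))
    where
    r≡anchor : r ≡ fromℕ< (bound j)
    r≡anchor = toℕ-injective (trans r≡fj+1 (sym (toℕ-fromℕ< (bound j))))

module _ where
  open Inverse 2↔Bool using (to; from; strictlyInverseˡ)

  encode : (Fin k → Bool) → Fin (2 ^ k)
  encode s = funToFin (from ∘ s)

  decode : Fin (2 ^ k) → Fin k → Bool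
  decode c = to ∘ finToFun c

  decode-encode : (s : Fin k → Bool) → decode (encode s) ≗ s
  decode-encode s i = trans (cong to (finToFun-funToFin (from ∘ s) i)) (strictlyInverseˡ (s i))

encode-injective : (s t : Fin k → Bool) → encode s ≡ encode t → s ≗ t
encode-injective s t eq i =
  trans (sym (decode-encode s i)) (trans (cong (λ c → decode c i) eq) (decode-encode t i))

distinct-columns-≤ : (P : Matrix m n) (signature : Fin n → Fin k → Bool)
  → (∀ x y → signature x ≗ signature y → ∀ r → P r x ≡ P r y)
  → (d : ℕ) (g : Fin d → Fin n)
  → ((c c' : Fin d) → ((r : Fin m) → P r (g c) ≡ P r (g c')) → c ≡ c')
  → d ≤ 2 ^ k
distinct-columns-≤ P signature determines d g distinct =
  injective⇒≤ {f = encode ∘ signature ∘ g} λ {c} {c'} eq →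
    distinct c c' (determines (g c) (g c') (encode-injective _ _ eq))

lemma3 : (m n p : ℕ) (P : Matrix m n) (f : Fin p → ℕ)
    → Injective _≡_ _≡_ f
    → ((j : Fin p) → suc (f j) < m)
    → ((i i' : Fin m) (k k' : Fin n) → Corner P i i' k k'
        → Σ (Fin p) (λ j → f j ≡ toℕ i))
    → (d : ℕ) (g : Fin d → Fin n)
    → ((c c' : Fin d) → ((r : Fin m) → P r (g c) ≡ P r (g c')) → c ≡ c')
    → d ≤ 2 ^ (suc p)
lemma3 zero n p P f _ _ _ =
  distinct-columns-≤ {k = suc p} P (λ _ _ → false) (λ _ _ _ ())
lemma3 (suc m) n p P f _ bound corners =
  distinct-columns-≤ P (anchorSignature P f bound)
    (anchorSignature-determines-column P f bound corners)
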